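{- Let $R$ and $E$ be ceers. If $R$ is hyperdark, $E$ has infinitely many equivalence classes, and $E\le_{\mathrm{c}}R$, then $E$ is hyperdark.
   Context: A ceer is a computably enumerable equivalence relation on $\omega$. $E\le_{\mathrm{c}}R$ means there is a computable $f$ with $x\mathrel{E}y\Leftrightarrow f(x)\mathrel{R}f(y)$ for all $x,y$. A transversal of an equivalence relation is a set whose distinct elements are pairwise inequivalent. A strong disjoint array is a sequence $(D_{f(n)})_{n\in\omega}$ of pairwise disjoint finite sets given by canonical indices, with $f$ computable; an infinite set is hyperimmune if no strong disjoint array has every member meeting it. A ceer is hyperdark if it has infinitely many classes and all of its infinite transversals are hyperimmune. -}

module Defs where

open import Data.Nat using (ℕ; zero; suc; _≤_; _<_)
open import Data.Nat.DivMod using (_/_; _%_)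
open import Data.Fin using (Fin)
open import Data.Vec using (Vec; []; _∷_; lookup)
open import Data.List using (List)
open import Data.List.Relation.Unary.All using (All)
open import Data.Product using (Σ; ∃; ∃-syntax; _×_)
open import Relation.Nullary using (¬_)
open import Relation.Binary.PropositionalEquality using (_≡_; _≢_)
open import Relation.Binary.Structures using (IsEquivalence)

-- Model of computation: codes for (partial) μ-recursive functions.

data PR : ℕ → Set where
  zer  : ∀ {n} → PR n
  succ : PR 1
  proj : ∀ {n} → Fin n → PR n
  comp : ∀ {m n} → PR m → Vec (PR n) m → PR n
  prec : ∀ {n} → PR n → PR (suc (suc n)) → PR (suc n)
  mu   : ∀ {n} → PR (suc n) → PR n

-- Big-step (halting) semantics: c [ xs ]⇓ y  means  c halts on xs with output y.
mutual
  data _[_]⇓_ : ∀ {n} → PR n → Vec ℕ n → ℕ → Set where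
    ev-zer  : ∀ {n} {xs : Vec ℕ n} → zer [ xs ]⇓ 0
    ev-succ : ∀ {x} → succ [ x ∷ [] ]⇓ suc x
    ev-proj : ∀ {n} {i : Fin n} {xs} → proj i [ xs ]⇓ lookup xs i
    ev-comp : ∀ {m n} {f : PR m} {gs : Vec (PR n) m} {xs ys y} →
              gs [ xs ]⇓* ys → f [ ys ]⇓ y → comp f gs [ xs ]⇓ y
    ev-prec0 : ∀ {n} {b : PR n} {s} {xs y} →
              b [ xs ]⇓ y → prec b s [ 0 ∷ xs ]⇓ y
    ev-precS : ∀ {n} {b : PR n} {s} {k xs z y} →
              prec b s [ k ∷ xs ]⇓ z → s [ k ∷ z ∷ xs ]⇓ y →
              prec b s [ suc k ∷ xs ]⇓ y
    ev-mu   : ∀ {n} {f : PR (suc n)} {xs y} →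
              f [ y ∷ xs ]⇓ 0 →
              (∀ z → z < y → ∃[ k ] (f [ z ∷ xs ]⇓ suc k)) →
              mu f [ xs ]⇓ y

  data _[_]⇓*_ : ∀ {m n} → Vec (PR n) m → Vec ℕ n → Vec ℕ m → Set where
    ev-[] : ∀ {n} {xs : Vec ℕ n} → [] [ xs ]⇓* []
    ev-∷  : ∀ {m n} {g : PR n} {gs : Vec (PR n) m} {xs y ys} →
            g [ xs ]⇓ y → gs [ xs ]⇓* ys → (g ∷ gs) [ xs ]⇓* (y ∷ ys)

Computable : (ℕ → ℕ) → Set
Computable f = Σ (PR 1) λ c → ∀ n → c [ n ∷ [] ]⇓ f n

IsCE₂ : (ℕ → ℕ → Set) → Set
IsCE₂ E = Σ (PR 2) λ c → ∀ x y →
  (E x y → ∃[ v ] (c [ x ∷ y ∷ [] ]⇓ v)) × (∃[ v ] (c [ x ∷ y ∷ [] ]⇓ v) → E x y)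

record Ceer : Set₁ where
  field
    rel   : ℕ → ℕ → Set
    isEq  : IsEquivalence rel
    isCE  : IsCE₂ rel

open Ceer public

_≤c_ : Ceer → Ceer → Set
E ≤c R = Σ (ℕ → ℕ) λ f → Computable f ×
  (∀ x y → (rel E x y → rel R (f x) (f y)) × (rel R (f x) (f y) → rel E x y))

Infinite : (ℕ → Set) → Set
Infinite A = ∀ n → ∃[ m ] (n ≤ m × A m)

InfinitelyManyClasses : Ceer → Set
InfinitelyManyClasses E = ∀ (xs : List ℕ) → ∃[ y ] All (λ x → ¬ rel E x y) xs

Transversal : Ceer → (ℕ → Set) → Set
Transversal E A = ∀ x y → A x → A y → x ≢ y → ¬ rel E x y

-- Canonical finite sets: i ∈ D_k iff the i-th binary digit of k is 1.
bit : ℕ → ℕ → ℕ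
bit k zero    = k % 2
bit k (suc i) = bit (k / 2) i

_∈D_ : ℕ → ℕ → Set
i ∈D k = bit k i ≡ 1

StrongDisjointArray : (ℕ → ℕ) → Set
StrongDisjointArray f = Computable f ×
  (∀ n m → n ≢ m → ∀ i → i ∈D f n → ¬ (i ∈D f m))

Meets : ℕ → (ℕ → Set) → Set
Meets k A = ∃[ i ] (i ∈D k × A i)

Hyperimmune : (ℕ → Set) → Set
Hyperimmune A = Infinite A ×
  ¬ (Σ (ℕ → ℕ) λ f → StrongDisjointArray f × (∀ n → Meets (f n) A))

Hyperdark : Ceer → Set₁
Hyperdark E = InfinitelyManyClasses E ×
  (∀ (A : ℕ → Set) → Infinite A → Transversal E A → Hyperimmune A)

{-# OPTIONS --safe #-}
-- Let E ≤c R via f, let A be an infinite transversal of E, and suppose the strong disjoint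
-- array (D_{g n}) meets A, say at a n ∈ D_{g n} ∩ A. The a n are distinct elements of A, so
-- the f (a n) are pairwise R-inequivalent and form an infinite transversal of R. Grouping the
-- finite sets f[D_{g n}] into consecutive blocks gives a strong disjoint array meeting it: if C
-- is the canonical index of the union of the first s of them, all its elements are below C,
-- while the next C + 1 of them contain C + 1 distinct values f (a n), one of which is ≥ C.
-- This contradicts the hyperdarkness of R.
module Submission where

open import Defs
open import Data.Nat
  using ( ℕ; zero; suc; _+_; _*_; _∸_; _^_; _≤_; _<_; _≤′_; ≤′-refl; ≤′-step
        ; z≤n; s≤s; s≤s⁻¹; ⌊_/2⌋; _≟_; _≤?_ )
open import Data.Nat.Properties
open import Data.Nat.DivMod using (_/_; _%_; m/n≡1+[m∸n]/n; [m+n]%n≡m%n)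
open import Data.Nat.Solver using (module +-*-Solver)
open import Data.Fin using (Fin; #_; toℕ; fromℕ<)
open import Data.Fin.Properties using (any?; toℕ<n; toℕ-injective; fromℕ<-injective; injective⇒≤)
open import Data.Vec using (Vec; []; _∷_; head; lookup)
open import Data.Product using (_×_; Σ; ∃-syntax; _,_; proj₁; proj₂)
open import Data.Sum using (_⊎_; inj₁; inj₂)
open import Data.Empty using (⊥-elim)
open import Relation.Nullary using (¬_; yes; no; contradiction)
open import Relation.Binary.PropositionalEquality
open import Function using (_∘′_; flip)
open import Relation.Binary.Definitions using (tri<; tri≈; tri>)
open import Relation.Binary.Structures using (IsEquivalence)
open import Function.Definitions using (Injective)
open +-*-Solver using (solve; _:+_; _:*_; _:=_; con)

IsBit : ℕ → Set
IsBit b = b ≡ 0 ⊎ b ≡ 1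

lowBit : ℕ → ℕ
lowBit zero          = 0
lowBit (suc zero)    = 1
lowBit (suc (suc k)) = lowBit k

lowBit-isBit : ∀ k → IsBit (lowBit k)
lowBit-isBit zero          = inj₁ refl
lowBit-isBit (suc zero)    = inj₂ refl
lowBit-isBit (suc (suc k)) = lowBit-isBit k

lowBit-suc : ∀ k → lowBit (suc k) ≡ 1 ∸ lowBit k
lowBit-suc zero          = refl
lowBit-suc (suc zero)    = refl
lowBit-suc (suc (suc k)) = lowBit-suc k

⌊suc/2⌋≡⌊/2⌋+lowBit : ∀ k → ⌊ suc k /2⌋ ≡ ⌊ k /2⌋ + lowBit k
⌊suc/2⌋≡⌊/2⌋+lowBit zero          = refl
⌊suc/2⌋≡⌊/2⌋+lowBit (suc zero)    = refl
⌊suc/2⌋≡⌊/2⌋+lowBit (suc (suc k)) = cong suc (⌊suc/2⌋≡⌊/2⌋+lowBit k)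

digit-shift : ∀ r q → r + 2 * suc q ≡ 2 + (r + 2 * q)
digit-shift = solve 2 (λ r q → r :+ con 2 :* (con 1 :+ q) := con 2 :+ (r :+ con 2 :* q)) refl

lowBit+2*⌊/2⌋ : ∀ k → lowBit k + 2 * ⌊ k /2⌋ ≡ k
lowBit+2*⌊/2⌋ zero          = refl
lowBit+2*⌊/2⌋ (suc zero)    = refl
lowBit+2*⌊/2⌋ (suc (suc k)) = begin
  lowBit k + 2 * suc ⌊ k /2⌋    ≡⟨ digit-shift (lowBit k) ⌊ k /2⌋ ⟩
  2 + (lowBit k + 2 * ⌊ k /2⌋)  ≡⟨ cong (2 +_) (lowBit+2*⌊/2⌋ k) ⟩
  2 + k                         ∎
  where open ≡-Reasoning

lowBit-digit : ∀ {r} q → IsBit r → lowBit (r + 2 * q) ≡ r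
lowBit-digit zero    (inj₁ refl) = refl
lowBit-digit zero    (inj₂ refl) = refl
lowBit-digit {r} (suc q) r-isBit = trans (cong lowBit (digit-shift r q)) (lowBit-digit q r-isBit)

⌊digit/2⌋ : ∀ {r} q → IsBit r → ⌊ r + 2 * q /2⌋ ≡ q
⌊digit/2⌋ zero    (inj₁ refl) = refl
⌊digit/2⌋ zero    (inj₂ refl) = refl
⌊digit/2⌋ {r} (suc q) r-isBit = trans (cong ⌊_/2⌋ (digit-shift r q)) (cong suc (⌊digit/2⌋ q r-isBit))

bit-zero : ∀ k → bit k 0 ≡ lowBit k
bit-zero zero          = refl
bit-zero (suc zero)    = refl
bit-zero (suc (suc k)) = trans (cong (_% 2) (+-comm 2 k)) (trans ([m+n]%n≡m%n k 2) (bit-zero k))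

n/2≡⌊n/2⌋ : ∀ k → k / 2 ≡ ⌊ k /2⌋
n/2≡⌊n/2⌋ zero          = refl
n/2≡⌊n/2⌋ (suc zero)    = refl
n/2≡⌊n/2⌋ (suc (suc k)) = trans (m/n≡1+[m∸n]/n {suc (suc k)} {2} (s≤s (s≤s z≤n))) (cong suc (n/2≡⌊n/2⌋ k))

bit-suc : ∀ k i → bit k (suc i) ≡ bit ⌊ k /2⌋ i
bit-suc k i = cong (λ m → bit m i) (n/2≡⌊n/2⌋ k)

bit-isBit : ∀ k i → IsBit (bit k i)
bit-isBit k zero    rewrite bit-zero k  = lowBit-isBit k
bit-isBit k (suc i) rewrite bit-suc k i = bit-isBit ⌊ k /2⌋ i

bit-digit-zero : ∀ {r} q → IsBit r → bit (r + 2 * q) 0 ≡ r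
bit-digit-zero {r} q r-isBit = trans (bit-zero (r + 2 * q)) (lowBit-digit q r-isBit)

bit-digit-suc : ∀ {r} q i → IsBit r → bit (r + 2 * q) (suc i) ≡ bit q i
bit-digit-suc {r} q i r-isBit = trans (bit-suc (r + 2 * q) i) (cong (λ m → bit m i) (⌊digit/2⌋ q r-isBit))

∉D0 : ∀ i → ¬ (i ∈D 0)
∉D0 zero    ()
∉D0 (suc i) = ∉D0 i

<⌊n/2⌋⇒1+<n : ∀ i n → i < ⌊ n /2⌋ → suc i < n
<⌊n/2⌋⇒1+<n zero    (suc (suc n)) _           = s≤s (s≤s z≤n)
<⌊n/2⌋⇒1+<n (suc i) (suc (suc n)) (s≤s i<n/2) = s≤s (m<n⇒m<1+n (<⌊n/2⌋⇒1+<n i n i<n/2))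

∈D⇒< : ∀ i k → i ∈D k → i < k
∈D⇒< i       zero    i∈0 = ⊥-elim (∉D0 i i∈0)
∈D⇒< zero    (suc k) _   = s≤s z≤n
∈D⇒< (suc i) k       i∈k = <⌊n/2⌋⇒1+<n i k (∈D⇒< i ⌊ k /2⌋ (trans (sym (bit-suc k i)) i∈k))

insert : ℕ → ℕ → ℕ
insert v a = a + 2 ^ v * (1 ∸ bit a v)

insert-zero : ∀ a → insert 0 a ≡ 1 + 2 * ⌊ a /2⌋
insert-zero a = begin
  a + 1 * (1 ∸ bit a 0)                    ≡⟨ cong (λ b → a + 1 * (1 ∸ b)) (bit-zero a) ⟩
  a + 1 * (1 ∸ lowBit a)                   ≡⟨ cong (a +_) (*-identityˡ (1 ∸ lowBit a)) ⟩
  a + (1 ∸ lowBit a)                       ≡⟨ cong (_+ (1 ∸ lowBit a)) (sym (lowBit+2*⌊/2⌋ a)) ⟩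
  lowBit a + 2 * ⌊ a /2⌋ + (1 ∸ lowBit a)  ≡⟨ fill-low-digit (lowBit-isBit a) ⟩
  1 + 2 * ⌊ a /2⌋                          ∎
  where
  open ≡-Reasoning
  fill-low-digit : ∀ {p q} → IsBit p → p + q + (1 ∸ p) ≡ 1 + q
  fill-low-digit {q = q} (inj₁ refl) = +-comm q 1
  fill-low-digit {q = q} (inj₂ refl) = +-identityʳ (1 + q)

insert-suc : ∀ v a → insert (suc v) a ≡ lowBit a + 2 * insert v ⌊ a /2⌋
insert-suc v a = begin
  a + 2 * 2 ^ v * (1 ∸ bit a (suc v))
    ≡⟨ cong₂ (λ m b → m + 2 * 2 ^ v * (1 ∸ b)) (sym (lowBit+2*⌊/2⌋ a)) (bit-suc a v) ⟩
  lowBit a + 2 * h + 2 * 2 ^ v * (1 ∸ bit h v)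
    ≡⟨ solve 4 (λ p h w t → p :+ con 2 :* h :+ con 2 :* w :* t := p :+ con 2 :* (h :+ w :* t)) refl
               (lowBit a) h (2 ^ v) (1 ∸ bit h v) ⟩
  lowBit a + 2 * (h + 2 ^ v * (1 ∸ bit h v))
    ∎
  where
  open ≡-Reasoning
  h = ⌊ a /2⌋

∈-insert-self : ∀ v a → v ∈D insert v a
∈-insert-self zero    a rewrite insert-zero a  = bit-digit-zero ⌊ a /2⌋ (inj₂ refl)
∈-insert-self (suc v) a rewrite insert-suc v a =
  trans (bit-digit-suc (insert v ⌊ a /2⌋) v (lowBit-isBit a)) (∈-insert-self v ⌊ a /2⌋)

bit-insert-other : ∀ v a i → i ≢ v → bit (insert v a) i ≡ bit a i
bit-insert-other zero    a zero    i≢v = ⊥-elim (i≢v refl)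
bit-insert-other zero    a (suc i) _   rewrite insert-zero a =
  trans (bit-digit-suc ⌊ a /2⌋ i (inj₂ refl)) (sym (bit-suc a i))
bit-insert-other (suc v) a zero    _   rewrite insert-suc v a =
  trans (bit-digit-zero (insert v ⌊ a /2⌋) (lowBit-isBit a)) (sym (bit-zero a))
bit-insert-other (suc v) a (suc i) i≢v rewrite insert-suc v a = begin
  bit (lowBit a + 2 * insert v ⌊ a /2⌋) (suc i) ≡⟨ bit-digit-suc (insert v ⌊ a /2⌋) i (lowBit-isBit a) ⟩
  bit (insert v ⌊ a /2⌋) i                      ≡⟨ bit-insert-other v ⌊ a /2⌋ i (i≢v ∘′ cong suc) ⟩
  bit ⌊ a /2⌋ i                                 ≡⟨ sym (bit-suc a i) ⟩
  bit a (suc i)                                 ∎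
  where open ≡-Reasoning

-- Written arithmetically (c is meant to be 0 or 1) so that it is visibly primitive recursive.
insertIf : ℕ → ℕ → ℕ → ℕ
insertIf c v a = a + c * (2 ^ v * (1 ∸ bit a v))

insertIf-zero : ∀ v a → insertIf 0 v a ≡ a
insertIf-zero v a = +-identityʳ a

insertIf-one : ∀ v a → insertIf 1 v a ≡ insert v a
insertIf-one v a = cong (a +_) (*-identityˡ _)

∈-insertIf-self : ∀ v a → v ∈D insertIf 1 v a
∈-insertIf-self v a = subst (v ∈D_) (sym (insertIf-one v a)) (∈-insert-self v a)

∈-insertIf⁺ : ∀ {c} x v a → IsBit c → x ∈D a → x ∈D insertIf c v a
∈-insertIf⁺ x v a (inj₁ refl) x∈a = subst (x ∈D_) (sym (insertIf-zero v a)) x∈a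
∈-insertIf⁺ x v a (inj₂ refl) x∈a with x ≟ v
... | yes refl = ∈-insertIf-self v a
... | no  x≢v  = subst (x ∈D_) (sym (insertIf-one v a)) (trans (bit-insert-other v a x x≢v) x∈a)

∈-insertIf⁻ : ∀ {c} x v a → IsBit c → x ∈D insertIf c v a → x ∈D a ⊎ (c ≡ 1 × v ≡ x)
∈-insertIf⁻ x v a (inj₁ refl) x∈ = inj₁ (subst (x ∈D_) (insertIf-zero v a) x∈)
∈-insertIf⁻ x v a (inj₂ refl) x∈ with x ≟ v
... | yes refl = inj₂ (refl , refl)
... | no  x≢v  = inj₁ (trans (sym (bit-insert-other v a x x≢v)) (subst (x ∈D_) (insertIf-one v a) x∈))

insertMarked : (ℕ → ℕ) → (ℕ → ℕ) → ℕ → ℕ → ℕ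
insertMarked v c zero    a = a
insertMarked v c (suc j) a = insertIf (c j) (v j) (insertMarked v c j a)

module _ (v c : ℕ → ℕ) (c-isBit : ∀ i → IsBit (c i)) where

  ∈-insertMarked⁺ˡ : ∀ x j a → x ∈D a → x ∈D insertMarked v c j a
  ∈-insertMarked⁺ˡ x zero    a x∈a = x∈a
  ∈-insertMarked⁺ˡ x (suc j) a x∈a = ∈-insertIf⁺ x (v j) _ (c-isBit j) (∈-insertMarked⁺ˡ x j a x∈a)

  ∈-insertMarked⁺ʳ : ∀ i j a → i < j → c i ≡ 1 → v i ∈D insertMarked v c j a
  ∈-insertMarked⁺ʳ i (suc j) a (s≤s i≤j) cᵢ≡1 with m≤n⇒m<n∨m≡n i≤j
  ... | inj₁ i<j  = ∈-insertIf⁺ (v i) (v j) _ (c-isBit j) (∈-insertMarked⁺ʳ i j a i<j cᵢ≡1)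
  ... | inj₂ refl = subst (λ b → v i ∈D insertIf b (v i) a′) (sym cᵢ≡1) (∈-insertIf-self (v i) a′)
    where a′ = insertMarked v c i a

  ∈-insertMarked⁻ : ∀ x j a → x ∈D insertMarked v c j a → x ∈D a ⊎ ∃[ i ] (i < j × c i ≡ 1 × v i ≡ x)
  ∈-insertMarked⁻ x zero    a x∈ = inj₁ x∈
  ∈-insertMarked⁻ x (suc j) a x∈ with ∈-insertIf⁻ x (v j) _ (c-isBit j) x∈
  ... | inj₂ (cⱼ≡1 , vⱼ≡x) = inj₂ (j , ≤-refl , cⱼ≡1 , vⱼ≡x)
  ... | inj₁ x∈′ with ∈-insertMarked⁻ x j a x∈′
  ...   | inj₁ x∈a               = inj₁ x∈a
  ...   | inj₂ (i , i<j , rest) = inj₂ (i , m<n⇒m<1+n i<j , rest)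

insertImage : (ℕ → ℕ) → ℕ → ℕ → ℕ
insertImage f d a = insertMarked f (bit d) d a

∈-insertImage⁺ˡ : ∀ x f d a → x ∈D a → x ∈D insertImage f d a
∈-insertImage⁺ˡ x f d a = ∈-insertMarked⁺ˡ f (bit d) (bit-isBit d) x d a

∈-insertImage⁺ʳ : ∀ i f d a → i ∈D d → f i ∈D insertImage f d a
∈-insertImage⁺ʳ i f d a i∈d = ∈-insertMarked⁺ʳ f (bit d) (bit-isBit d) i d a (∈D⇒< i d i∈d) i∈d

andNot : ℕ → ℕ → ℕ
andNot p q = p * (1 ∸ q)

andNot-isBit : ∀ {p q} → IsBit p → IsBit q → IsBit (andNot p q)
andNot-isBit (inj₁ refl) _           = inj₁ refl
andNot-isBit (inj₂ refl) (inj₁ refl) = inj₂ refl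
andNot-isBit (inj₂ refl) (inj₂ refl) = inj₁ refl

andNot≡1⁺ : ∀ {p q} → p ≡ 1 → IsBit q → q ≢ 1 → andNot p q ≡ 1
andNot≡1⁺ refl (inj₁ refl) _   = refl
andNot≡1⁺ refl (inj₂ refl) q≢1 = ⊥-elim (q≢1 refl)

andNot≡1⁻ : ∀ {p q} → IsBit p → IsBit q → andNot p q ≡ 1 → p ≡ 1 × q ≢ 1
andNot≡1⁻ (inj₁ refl) _           ()
andNot≡1⁻ (inj₂ refl) (inj₁ refl) _ = refl , λ ()
andNot≡1⁻ (inj₂ refl) (inj₂ refl) ()

_∖D_ : ℕ → ℕ → ℕ
b ∖D a = insertMarked (λ j → j) (λ j → andNot (bit b j) (bit a j)) b 0

∈-∖D⁺ : ∀ x b a → x ∈D b → ¬ (x ∈D a) → x ∈D (b ∖D a)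
∈-∖D⁺ x b a x∈b x∉a =
  ∈-insertMarked⁺ʳ (λ j → j) _ (λ j → andNot-isBit (bit-isBit b j) (bit-isBit a j)) x b 0 (∈D⇒< x b x∈b)
    (andNot≡1⁺ x∈b (bit-isBit a x) x∉a)

∈-∖D⁻ : ∀ x b a → x ∈D (b ∖D a) → x ∈D b × ¬ (x ∈D a)
∈-∖D⁻ x b a x∈ with ∈-insertMarked⁻ (λ j → j) _ (λ j → andNot-isBit (bit-isBit b j) (bit-isBit a j)) x b 0 x∈
... | inj₁ x∈0                 = ⊥-elim (∉D0 x x∈0)
... | inj₂ (_ , _ , marked , refl) = andNot≡1⁻ (bit-isBit b x) (bit-isBit a x) marked

Computableⁿ : (n : ℕ) → (Vec ℕ n → ℕ) → Set
Computableⁿ n F = Σ (PR n) λ c → ∀ xs → c [ xs ]⇓ F xs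

infixr 5 _∷ᶜ_
data Computablesⁿ (n : ℕ) : ℕ → Set where
  []ᶜ  : Computablesⁿ n 0
  _∷ᶜ_ : ∀ {m} {F : Vec ℕ n → ℕ} → Computableⁿ n F → Computablesⁿ n m → Computablesⁿ n (suc m)

codes : ∀ {n m} → Computablesⁿ n m → Vec (PR n) m
codes []ᶜ       = []
codes (c ∷ᶜ cs) = proj₁ c ∷ codes cs

outputs : ∀ {n m} → Computablesⁿ n m → Vec ℕ n → Vec ℕ m
outputs []ᶜ                   xs = []
outputs (_∷ᶜ_ {F = F} _ cs) xs = F xs ∷ outputs cs xs

codes⇓outputs : ∀ {n m} (cs : Computablesⁿ n m) xs → codes cs [ xs ]⇓* outputs cs xs
codes⇓outputs []ᶜ       xs = ev-[]
codes⇓outputs (c ∷ᶜ cs) xs = ev-∷ (proj₂ c xs) (codes⇓outputs cs xs)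

fromComputable : ∀ {f} → Computable f → Computableⁿ 1 (λ xs → f (head xs))
fromComputable (c , c⇓) = c , λ { (x ∷ []) → c⇓ x }

toComputable : ∀ {f} → Computableⁿ 1 (λ xs → f (head xs)) → Computable f
toComputable (c , c⇓) = c , λ x → c⇓ (x ∷ [])

extᶜ : ∀ {n} {F G : Vec ℕ n → ℕ} → Computableⁿ n F → (∀ xs → F xs ≡ G xs) → Computableⁿ n G
extᶜ (c , c⇓) F≗G = c , λ xs → subst (c [ xs ]⇓_) (F≗G xs) (c⇓ xs)

zeroᶜ : ∀ {n} → Computableⁿ n (λ _ → 0)
zeroᶜ = zer , λ _ → ev-zer

sucᶜ : Computableⁿ 1 (λ xs → suc (head xs))
sucᶜ = succ , λ { (x ∷ []) → ev-succ }

projᶜ : ∀ {n} (i : Fin n) → Computableⁿ n (λ xs → lookup xs i)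
projᶜ i = proj i , λ _ → ev-proj

compᶜ : ∀ {m n} {F : Vec ℕ m → ℕ} → Computableⁿ m F → (gs : Computablesⁿ n m) →
        Computableⁿ n (λ xs → F (outputs gs xs))
compᶜ (c , c⇓) gs = comp c (codes gs) , λ xs → ev-comp (codes⇓outputs gs xs) (c⇓ (outputs gs xs))

precᶜ : ∀ {n} {B : Vec ℕ n → ℕ} {S : Vec ℕ (suc (suc n)) → ℕ} →
        Computableⁿ n B → Computableⁿ (suc (suc n)) S → (F : Vec ℕ (suc n) → ℕ) →
        (∀ xs → F (0 ∷ xs) ≡ B xs) → (∀ k xs → F (suc k ∷ xs) ≡ S (k ∷ F (k ∷ xs) ∷ xs)) →
        Computableⁿ (suc n) F
precᶜ (b , b⇓) (s , s⇓) F F-zero F-suc = prec b s , λ { (k ∷ xs) → prec⇓ k xs }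
  where
  prec⇓ : ∀ k xs → prec b s [ k ∷ xs ]⇓ F (k ∷ xs)
  prec⇓ zero    xs = subst (prec b s [ 0 ∷ xs ]⇓_) (sym (F-zero xs)) (ev-prec0 (b⇓ xs))
  prec⇓ (suc k) xs = subst (prec b s [ suc k ∷ xs ]⇓_) (sym (F-suc k xs))
                           (ev-precS (prec⇓ k xs) (s⇓ (k ∷ F (k ∷ xs) ∷ xs)))

oneᶜ : ∀ {n} → Computableⁿ n (λ _ → 1)
oneᶜ = compᶜ sucᶜ (zeroᶜ ∷ᶜ []ᶜ)

1∸ᶜ : Computableⁿ 1 (λ xs → 1 ∸ head xs)
1∸ᶜ = precᶜ oneᶜ zeroᶜ _ (λ _ → refl) (λ k _ → 0∸n≡0 k)

+ᶜ : Computableⁿ 2 (λ xs → lookup xs (# 0) + lookup xs (# 1))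
+ᶜ = precᶜ (projᶜ (# 0)) (compᶜ sucᶜ (projᶜ (# 1) ∷ᶜ []ᶜ)) _ (λ _ → refl) (λ _ _ → refl)

*ᶜ : Computableⁿ 2 (λ xs → lookup xs (# 0) * lookup xs (# 1))
*ᶜ = precᶜ zeroᶜ (compᶜ +ᶜ (projᶜ (# 2) ∷ᶜ projᶜ (# 1) ∷ᶜ []ᶜ)) _ (λ _ → refl) (λ _ _ → refl)

2^ᶜ : Computableⁿ 1 (λ xs → 2 ^ head xs)
2^ᶜ = precᶜ oneᶜ (compᶜ +ᶜ (projᶜ (# 1) ∷ᶜ projᶜ (# 1) ∷ᶜ []ᶜ)) _ (λ _ → refl)
        (λ k _ → cong (2 ^ k +_) (+-identityʳ (2 ^ k)))

lowBitᶜ : Computableⁿ 1 (λ xs → lowBit (head xs))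
lowBitᶜ = precᶜ zeroᶜ (compᶜ 1∸ᶜ (projᶜ (# 1) ∷ᶜ []ᶜ)) _ (λ _ → refl) (λ k _ → lowBit-suc k)

⌊/2⌋ᶜ : Computableⁿ 1 (λ xs → ⌊ head xs /2⌋)
⌊/2⌋ᶜ = precᶜ zeroᶜ (compᶜ +ᶜ (projᶜ (# 1) ∷ᶜ compᶜ lowBitᶜ (projᶜ (# 0) ∷ᶜ []ᶜ) ∷ᶜ []ᶜ)) _
          (λ _ → refl) (λ k _ → ⌊suc/2⌋≡⌊/2⌋+lowBit k)

halve : ℕ → ℕ → ℕ
halve zero    k = k
halve (suc i) k = ⌊ halve i k /2⌋

halveᶜ : Computableⁿ 2 (λ xs → halve (lookup xs (# 0)) (lookup xs (# 1)))
halveᶜ = precᶜ (projᶜ (# 0)) (compᶜ ⌊/2⌋ᶜ (projᶜ (# 1) ∷ᶜ []ᶜ)) _ (λ _ → refl) (λ _ _ → refl)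

lowBit∘halve≡bit : ∀ i k → lowBit (halve i k) ≡ bit k i
lowBit∘halve≡bit zero    k = sym (bit-zero k)
lowBit∘halve≡bit (suc i) k = begin
  lowBit ⌊ halve i k /2⌋  ≡⟨ cong lowBit (halve-⌊/2⌋ i k) ⟩
  lowBit (halve i ⌊ k /2⌋) ≡⟨ lowBit∘halve≡bit i ⌊ k /2⌋ ⟩
  bit ⌊ k /2⌋ i            ≡⟨ sym (bit-suc k i) ⟩
  bit k (suc i)            ∎
  where
  open ≡-Reasoning
  halve-⌊/2⌋ : ∀ i k → ⌊ halve i k /2⌋ ≡ halve i ⌊ k /2⌋
  halve-⌊/2⌋ zero    k = refl
  halve-⌊/2⌋ (suc i) k = cong ⌊_/2⌋ (halve-⌊/2⌋ i k)

bitᶜ : Computableⁿ 2 (λ xs → bit (lookup xs (# 0)) (lookup xs (# 1)))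
bitᶜ = extᶜ (compᶜ lowBitᶜ (compᶜ halveᶜ (projᶜ (# 1) ∷ᶜ projᶜ (# 0) ∷ᶜ []ᶜ) ∷ᶜ []ᶜ))
            (λ { (k ∷ i ∷ []) → lowBit∘halve≡bit i k })

insertIfᶜ : Computableⁿ 3 (λ xs → insertIf (lookup xs (# 0)) (lookup xs (# 1)) (lookup xs (# 2)))
insertIfᶜ = extᶜ
  (compᶜ +ᶜ (projᶜ (# 2) ∷ᶜ compᶜ *ᶜ (projᶜ (# 0) ∷ᶜ compᶜ *ᶜ (compᶜ 2^ᶜ (projᶜ (# 1) ∷ᶜ []ᶜ)
    ∷ᶜ compᶜ 1∸ᶜ (compᶜ bitᶜ (projᶜ (# 2) ∷ᶜ projᶜ (# 1) ∷ᶜ []ᶜ) ∷ᶜ []ᶜ) ∷ᶜ []ᶜ) ∷ᶜ []ᶜ) ∷ᶜ []ᶜ))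
  (λ { (c ∷ v ∷ a ∷ []) → refl })

andNotᶜ : Computableⁿ 2 (λ xs → andNot (lookup xs (# 0)) (lookup xs (# 1)))
andNotᶜ = compᶜ *ᶜ (projᶜ (# 0) ∷ᶜ compᶜ 1∸ᶜ (projᶜ (# 1) ∷ᶜ []ᶜ) ∷ᶜ []ᶜ)

∖Dᶜ : Computableⁿ 2 (λ xs → lookup xs (# 0) ∖D lookup xs (# 1))
∖Dᶜ = extᶜ (compᶜ marked (projᶜ (# 0) ∷ᶜ projᶜ (# 0) ∷ᶜ projᶜ (# 1) ∷ᶜ []ᶜ)) (λ { (b ∷ a ∷ []) → refl })
  where
  marked : Computableⁿ 3 (λ xs → insertMarked (λ j → j)
             (λ j → andNot (bit (lookup xs (# 1)) j) (bit (lookup xs (# 2)) j)) (lookup xs (# 0)) 0)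
  marked = precᶜ zeroᶜ
    (compᶜ insertIfᶜ (compᶜ andNotᶜ (compᶜ bitᶜ (projᶜ (# 2) ∷ᶜ projᶜ (# 0) ∷ᶜ []ᶜ)
                                  ∷ᶜ compᶜ bitᶜ (projᶜ (# 3) ∷ᶜ projᶜ (# 0) ∷ᶜ []ᶜ) ∷ᶜ []ᶜ)
                      ∷ᶜ projᶜ (# 0) ∷ᶜ projᶜ (# 1) ∷ᶜ []ᶜ))
    _ (λ { (b ∷ a ∷ []) → refl }) (λ { k (b ∷ a ∷ []) → refl })

injective⇒unbounded : ∀ {y : ℕ → ℕ} → Injective _≡_ _≡_ y → ∀ c → ∃[ j ] (j ≤ c × c ≤ y j)
injective⇒unbounded {y} y-injective c with any? (λ (i : Fin (suc c)) → c ≤? y (toℕ i))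
... | yes (i , c≤yᵢ) = toℕ i , s≤s⁻¹ (toℕ<n i) , c≤yᵢ
... | no  ∄i         = contradiction (injective⇒≤ squeeze-injective) (n≮n c)
  where
  y<c : ∀ (i : Fin (suc c)) → y (toℕ i) < c
  y<c i = ≰⇒> (λ c≤yᵢ → ∄i (i , c≤yᵢ))
  squeeze : Fin (suc c) → Fin c
  squeeze i = fromℕ< (y<c i)
  squeeze-injective : Injective _≡_ _≡_ squeeze
  squeeze-injective {i} {j} eq = toℕ-injective (y-injective (fromℕ<-injective _ _ (y<c i) (y<c j) eq))

Range : (ℕ → ℕ) → ℕ → Set
Range y z = ∃[ n ] (y n ≡ z)

range-infinite : ∀ {y} → Injective _≡_ _≡_ y → Infinite (Range y)
range-infinite {y} y-injective c with j , _ , c≤yⱼ ← injective⇒unbounded y-injective c = y j , c≤yⱼ , j , refl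

PairwiseInequivalent : Ceer → (ℕ → ℕ) → Set
PairwiseInequivalent E y = ∀ n m → n ≢ m → ¬ rel E (y n) (y m)

pairwiseInequivalent⇒injective : ∀ E {y} → PairwiseInequivalent E y → Injective _≡_ _≡_ y
pairwiseInequivalent⇒injective E {y} y-inequivalent {n} {m} yₙ≡yₘ with n ≟ m
... | yes n≡m = n≡m
... | no  n≢m =
  contradiction (subst (rel E (y n)) yₙ≡yₘ (IsEquivalence.refl (isEq E))) (y-inequivalent n m n≢m)

range-transversal : ∀ E {y} → PairwiseInequivalent E y → Transversal E (Range y)
range-transversal E {y} y-inequivalent _ _ (n , refl) (m , refl) yₙ≢yₘ = y-inequivalent n m (yₙ≢yₘ ∘′ cong y)

selection-pairwiseInequivalent : ∀ E {A : ℕ → Set} (g a : ℕ → ℕ) → Transversal E A →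
                                 (∀ n m → n ≢ m → ∀ i → i ∈D g n → ¬ (i ∈D g m)) →
                                 (∀ n → a n ∈D g n × A (a n)) → PairwiseInequivalent E a
selection-pairwiseInequivalent E {A} g a A-transversal g-disjoint a-selects n m n≢m =
  A-transversal (a n) (a m) (proj₂ (a-selects n)) (proj₂ (a-selects m)) aₙ≢aₘ
  where
  aₙ≢aₘ : a n ≢ a m
  aₙ≢aₘ aₙ≡aₘ =
    g-disjoint n m n≢m (a n) (proj₁ (a-selects n)) (subst (_∈D g m) (sym aₙ≡aₘ) (proj₁ (a-selects m)))

module Thinning (f g : ℕ → ℕ) where

  covered : ℕ → ℕ
  covered zero    = 0
  covered (suc s) = insertImage f (g s) (covered s)

  covered-mono : ∀ {s s′} → s ≤ s′ → ∀ x → x ∈D covered s → x ∈D covered s′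
  covered-mono s≤s′ x = go (≤⇒≤′ s≤s′)
    where
    go : ∀ {s s′} → s ≤′ s′ → x ∈D covered s → x ∈D covered s′
    go ≤′-refl          x∈ = x∈
    go (≤′-step s≤′s′) x∈ = ∈-insertImage⁺ˡ x f (g _) _ (go s≤′s′ x∈)

  ∈-covered : ∀ {n s} → n < s → ∀ i → i ∈D g n → f i ∈D covered s
  ∈-covered {n} n<s i i∈gₙ = covered-mono n<s (f i) (∈-insertImage⁺ʳ i f (g n) (covered n) i∈gₙ)

  stage : ℕ → ℕ
  stage zero    = 0
  stage (suc k) = suc (stage k + covered (stage k))

  stage-mono : ∀ {k k′} → k ≤ k′ → stage k ≤ stage k′
  stage-mono k≤k′ = go (≤⇒≤′ k≤k′)
    where
    go : ∀ {k k′} → k ≤′ k′ → stage k ≤ stage k′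
    go ≤′-refl          = ≤-refl
    go (≤′-step k≤′k′) = ≤-trans (go k≤′k′) (m≤n⇒m≤1+n (m≤m+n _ _))

  block : ℕ → ℕ
  block k = covered (stage (suc k)) ∖D covered (stage k)

  block<-disjoint : ∀ {k k′} → k < k′ → ∀ i → i ∈D block k → ¬ (i ∈D block k′)
  block<-disjoint {k} {k′} k<k′ i i∈k i∈k′ =
    proj₂ (∈-∖D⁻ i (covered (stage (suc k′))) (covered (stage k′)) i∈k′)
          (covered-mono (stage-mono k<k′) i
                        (proj₁ (∈-∖D⁻ i (covered (stage (suc k))) (covered (stage k)) i∈k)))

  block-disjoint : ∀ k k′ → k ≢ k′ → ∀ i → i ∈D block k → ¬ (i ∈D block k′)
  block-disjoint k k′ k≢k′ i with <-cmp k k′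
  ... | tri< k<k′ _ _ = block<-disjoint k<k′ i
  ... | tri≈ _ k≡k′ _ = contradiction k≡k′ k≢k′
  ... | tri> _ _ k′<k = flip (block<-disjoint k′<k i)

  block-meets-range : ∀ (a : ℕ → ℕ) → (∀ n → a n ∈D g n) → Injective _≡_ _≡_ (f ∘′ a) →
                      ∀ k → Meets (block k) (Range (f ∘′ a))
  block-meets-range a a∈g fa-injective k =
    let j , j≤c , c≤fresh = injective⇒unbounded shifted-injective c
        fresh = f (a (s + j))
    in fresh ,
       ∈-∖D⁺ fresh (covered (stage (suc k))) c
             (∈-covered (s≤s (+-monoʳ-≤ s j≤c)) (a (s + j)) (a∈g (s + j)))
             (λ fresh∈c → <⇒≱ (∈D⇒< fresh c fresh∈c) c≤fresh) ,
       s + j , refl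
    where
    s = stage k
    c = covered s
    shifted-injective : Injective _≡_ _≡_ (λ j → f (a (s + j)))
    shifted-injective eq = +-cancelˡ-≡ s _ _ (fa-injective eq)

  module _ (f-computable : Computable f) (g-computable : Computable g) where

    insertImageᶜ : Computableⁿ 2 (λ xs → insertImage f (lookup xs (# 0)) (lookup xs (# 1)))
    insertImageᶜ = extᶜ (compᶜ marked (projᶜ (# 0) ∷ᶜ projᶜ (# 1) ∷ᶜ projᶜ (# 0) ∷ᶜ []ᶜ))
                        (λ { (d ∷ a ∷ []) → refl })
      where
      marked : Computableⁿ 3 (λ xs → insertMarked f (bit (lookup xs (# 2)))
                                                  (lookup xs (# 0)) (lookup xs (# 1)))
      marked = precᶜ (projᶜ (# 0))
        (compᶜ insertIfᶜ (compᶜ bitᶜ (projᶜ (# 3) ∷ᶜ projᶜ (# 0) ∷ᶜ []ᶜ)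
                          ∷ᶜ compᶜ (fromComputable f-computable) (projᶜ (# 0) ∷ᶜ []ᶜ) ∷ᶜ projᶜ (# 1) ∷ᶜ []ᶜ))
        _ (λ { (a ∷ d ∷ []) → refl }) (λ { k (a ∷ d ∷ []) → refl })

    coveredᶜ : Computableⁿ 1 (λ xs → covered (head xs))
    coveredᶜ = precᶜ zeroᶜ
      (compᶜ insertImageᶜ (compᶜ (fromComputable g-computable) (projᶜ (# 0) ∷ᶜ []ᶜ) ∷ᶜ projᶜ (# 1) ∷ᶜ []ᶜ))
      _ (λ { [] → refl }) (λ { k [] → refl })

    stageᶜ : Computableⁿ 1 (λ xs → stage (head xs))
    stageᶜ = precᶜ zeroᶜ
      (compᶜ sucᶜ (compᶜ +ᶜ (projᶜ (# 1) ∷ᶜ compᶜ coveredᶜ (projᶜ (# 1) ∷ᶜ []ᶜ) ∷ᶜ []ᶜ) ∷ᶜ []ᶜ))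
      _ (λ { [] → refl }) (λ { k [] → refl })

    block-computable : Computable block
    block-computable = toComputable (extᶜ
      (compᶜ ∖Dᶜ (compᶜ coveredᶜ (compᶜ stageᶜ (compᶜ sucᶜ (projᶜ (# 0) ∷ᶜ []ᶜ) ∷ᶜ []ᶜ) ∷ᶜ []ᶜ)
                ∷ᶜ compᶜ coveredᶜ (compᶜ stageᶜ (projᶜ (# 0) ∷ᶜ []ᶜ) ∷ᶜ []ᶜ) ∷ᶜ []ᶜ))
      (λ { (k ∷ []) → refl }))

lemma2p3 : (R E : Ceer) → Hyperdark R → InfinitelyManyClasses E → E ≤c R → Hyperdark E
lemma2p3 R E (_ , R-hyperdark) E-classes (f , f-computable , f-reduces) =
  E-classes , λ A A-infinite A-transversal → A-infinite , no-array-meets A A-transversal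
  where
  no-array-meets : ∀ A → Transversal E A → ¬ (Σ (ℕ → ℕ) λ g → StrongDisjointArray g × (∀ n → Meets (g n) A))
  no-array-meets A A-transversal (g , (g-computable , g-disjoint) , g-meets) =
    proj₂ (R-hyperdark (Range y) (range-infinite y-injective) (range-transversal R y-inequivalent))
          (block , (block-computable f-computable g-computable , block-disjoint) ,
           block-meets-range a (λ n → proj₁ (a-selects n)) y-injective)
    where
    open Thinning f g
    a : ℕ → ℕ
    a n = proj₁ (g-meets n)
    a-selects : ∀ n → a n ∈D g n × A (a n)
    a-selects n = proj₂ (g-meets n)
    y : ℕ → ℕ
    y = f ∘′ a
    y-inequivalent : PairwiseInequivalent R y
    y-inequivalent n m n≢m = selection-pairwiseInequivalent E g a A-transversal g-disjoint a-selects n m n≢m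
                               ∘′ proj₂ (f-reduces (a n) (a m))
    y-injective : Injective _≡_ _≡_ y
    y-injective = pairwiseInequivalent⇒injective R y-inequivalent
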